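{- Let $I$ be a Boolean edge CSP instance all of whose constraint relations are even $\Delta$-matroids. If $f$ and $g$ are valid edge labelings of $I$, then the numbers of inconsistent variables in $f$ and in $g$ are congruent modulo $2$.
   Context: A nonempty $M\subseteq\{0,1\}^V$ is a $\Delta$-matroid if for all $\alpha,\beta\in M$ and $v$ with $\alpha(v)\ne\beta(v)$ there is $u$ with $\alpha(u)\ne\beta(u)$ such that flipping $\alpha$ at $u$ and $v$ (only at $v$ if $u=v$) gives an element of $M$; it is even if all its tuples have the same parity of number of ones. A Boolean edge CSP instance $I=(V,\mathcal C)$: finite variable set $V$, finite constraint set $\mathcal C$, each $C$ with nonempty scope $\sigma_C\subseteq V$ and relation $C\subseteq\{0,1\}^{\sigma_C}$; each variable lies in the scopes of exactly two distinct constraints. $\mathcal E=\{\{v,C\}:v\in\sigma_C\}$. An edge labeling is $f:\mathcal E\to\{0,1\}$, $f(C)(v)=f(\{v,C\})$; valid if $f(C)\in C$ for all $C$. A variable $v$ in the scopes of $A\neq B$ is inconsistent in $f$ if $f(\{v,A\})\ne f(\{v,B\})$. -}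

module Defs where

open import Data.Nat using (ℕ; _≥_; _%_)
open import Data.Bool using (Bool; true; false; not; _xor_)
open import Data.Fin using (Fin; _≟_)
open import Data.Vec using (Vec; lookup; updateAt; countᵇ; allFin)
open import Data.Product using (Σ; ∃; _×_)
open import Data.Sum using (_⊎_)
open import Relation.Nullary using (¬_; yes; no)
open import Relation.Binary.PropositionalEquality using (_≡_; _≢_)
open import Function using (id)

-- A k-ary Boolean tuple is a Vec Bool k (coordinates = positions of the scope).
-- A relation on k coordinates is a predicate on Vec Bool k.

flipAt : ∀ {k} → Vec Bool k → Fin k → Vec Bool k
flipAt α v = updateAt α v not

flip2 : ∀ {k} → Vec Bool k → Fin k → Fin k → Vec Bool k
flip2 α u v with u ≟ v
... | yes _ = flipAt α v
... | no  _ = flipAt (flipAt α u) v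

IsDeltaMatroid : ∀ {k} → (Vec Bool k → Set) → Set
IsDeltaMatroid {k} M =
  (∃ λ α → M α) ×
  (∀ α β → M α → M β → (v : Fin k) → lookup α v ≢ lookup β v →
     Σ (Fin k) λ u → lookup α u ≢ lookup β u × M (flip2 α u v))

ones : ∀ {k} → Vec Bool k → ℕ
ones α = countᵇ id α

IsEven : ∀ {k} → (Vec Bool k → Set) → Set
IsEven M = ∀ α β → M α → M β → ones α % 2 ≡ ones β % 2

IsEvenDeltaMatroid : ∀ {k} → (Vec Bool k → Set) → Set
IsEvenDeltaMatroid M = IsDeltaMatroid M × IsEven M

record EdgeCSP (n m : ℕ) : Set₁ where
  field
    arity    : Fin m → ℕ
    nonempty : ∀ c → arity c ≥ 1
    scope    : (c : Fin m) → Vec (Fin n) (arity c)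
    distinct : ∀ c (i j : Fin (arity c)) → lookup (scope c) i ≡ lookup (scope c) j → i ≡ j
    rel      : (c : Fin m) → Vec Bool (arity c) → Set
    con₁ con₂ : Fin n → Fin m
    con-distinct : ∀ v → con₁ v ≢ con₂ v
    pos₁     : (v : Fin n) → Fin (arity (con₁ v))
    pos₂     : (v : Fin n) → Fin (arity (con₂ v))
    at₁      : ∀ v → lookup (scope (con₁ v)) (pos₁ v) ≡ v
    at₂      : ∀ v → lookup (scope (con₂ v)) (pos₂ v) ≡ v
    only-two : ∀ v c (i : Fin (arity c)) → lookup (scope c) i ≡ v → c ≡ con₁ v ⊎ c ≡ con₂ v

module _ {n m : ℕ} (I : EdgeCSP n m) where
  open EdgeCSP I

  -- an edge labeling: f c is the tuple f(C), its i-th entry labels the edge {scope c [i], c}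
  Labeling : Set
  Labeling = (c : Fin m) → Vec Bool (arity c)

  Valid : Labeling → Set
  Valid f = ∀ c → rel c (f c)

  inconsistentᵇ : Labeling → Fin n → Bool
  inconsistentᵇ f v = lookup (f (con₁ v)) (pos₁ v) xor lookup (f (con₂ v)) (pos₂ v)

  numInconsistent : Labeling → ℕ
  numInconsistent f = countᵇ (inconsistentᵇ f) (allFin n)

-- Weight each edge by whether the valid labelings f and g disagree on it and
-- count the disagreeing edges modulo 2 in two ways. Grouped by constraint, C
-- contributes ones f(C) + ones g(C), which is even since both tuples lie in the
-- same even relation. Grouped by variable, which lies on exactly two edges, v
-- contributes an odd amount exactly when v is inconsistent in one of f, g but
-- not the other.
module Submission where

open import Algebra.Bundles using (CommutativeMonoid; CommutativeRing)
import Algebra.Properties.CommutativeMonoid.Sum as MonoidSum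
import Algebra.Properties.CommutativeSemigroup
open import Data.Bool using (Bool; true; false; not; _xor_; if_then_else_)
open import Data.Bool.Properties
  using (not-involutive; xor-same; xor-∧-commutativeRing)
open import Data.Fin using (Fin; _≟_; punchIn; punchOut)
open import Data.Fin.Properties using (punchInᵢ≢i; punchIn-injective; punchIn-punchOut)
open import Data.Nat using (ℕ; zero; suc; _%_)
open import Data.Product using (proj₂)
open import Data.Sum using ([_,_])
open import Data.Vec using (Vec; []; _∷_; lookup; countᵇ; allFin)
open import Data.Vec.Functional using (Vector; removeAt)
open import Data.Vec.Properties using (lookup-allFin)
open import Function using (id)
open import Relation.Nullary.Decidable using (does; dec-true; dec-false)
import Relation.Binary.PropositionalEquality as ≡
open ≡ using (_≡_; _≢_)
import Relation.Binary.Reasoning.Setoid as SetoidReasoning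

open import Defs

module SupportedSums {a ℓ} (M : CommutativeMonoid a ℓ) where
  open CommutativeMonoid M
  open MonoidSum M
  open SetoidReasoning setoid

  sum-vanishing : ∀ {n} (t : Vector Carrier n) → (∀ i → t i ≈ ε) → sum t ≈ ε
  sum-vanishing {n} t t≈ε = trans (sum-cong-≋ t≈ε) (sum-replicate-zero n)

  sum-supported-at : ∀ {n} (t : Vector Carrier n) i →
                     (∀ j → j ≢ i → t j ≈ ε) → sum t ≈ t i
  sum-supported-at {suc n} t i t≈ε = begin
    sum t                     ≈⟨ sum-remove t ⟩
    t i ∙ sum (removeAt t i)  ≈⟨ ∙-congˡ (sum-vanishing _ (λ j → t≈ε _ (punchInᵢ≢i i j))) ⟩
    t i ∙ ε                   ≈⟨ identityʳ (t i) ⟩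
    t i                       ∎

  sum-supported-at-pair : ∀ {n} (t : Vector Carrier n) {i j} → i ≢ j →
                          (∀ k → k ≢ i → k ≢ j → t k ≈ ε) → sum t ≈ t i ∙ t j
  sum-supported-at-pair {suc n} t {i} {j} i≢j t≈ε = begin
    sum t                               ≈⟨ sum-remove t ⟩
    t i ∙ sum (removeAt t i)            ≈⟨ ∙-congˡ (sum-supported-at _ j′ vanishing) ⟩
    t i ∙ t (punchIn i j′)              ≡⟨ ≡.cong (λ k → t i ∙ t k) (punchIn-punchOut i≢j) ⟩
    t i ∙ t j                           ∎
    where
    j′ = punchOut i≢j
    vanishing : ∀ k → k ≢ j′ → t (punchIn i k) ≈ ε
    vanishing k k≢j′ = t≈ε _ (punchInᵢ≢i i k) λ eq →
      k≢j′ (punchIn-injective i k j′ (≡.trans eq (≡.sym (punchIn-punchOut i≢j))))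

module Handshake {a ℓ} (M : CommutativeMonoid a ℓ) {n m : ℕ} (I : EdgeCSP n m) where
  open CommutativeMonoid M
  open MonoidSum M
  open SupportedSums M
  open SetoidReasoning setoid
  open EdgeCSP I

  EdgeWeight : Set a
  EdgeWeight = (c : Fin m) → Fin (arity c) → Carrier

  module _ (w : EdgeWeight) where

    incidentWeight : Fin n → (c : Fin m) → Fin (arity c) → Carrier
    incidentWeight v c i = if does (lookup (scope c) i ≟ v) then w c i else ε

    incidentWeight-≢ : ∀ {v c i} → lookup (scope c) i ≢ v → incidentWeight v c i ≡ ε
    incidentWeight-≢ {v} {c} {i} ≢v = ≡.cong (if_then w c i else ε) (dec-false (_ ≟ v) ≢v)

    incidentWeight-≡ : ∀ {v c i} → lookup (scope c) i ≡ v → incidentWeight v c i ≡ w c i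
    incidentWeight-≡ {v} {c} {i} ≡v = ≡.cong (if_then w c i else ε) (dec-true (_ ≟ v) ≡v)

    sum-incidentWeight-edge : ∀ c i → ∑[ v < n ] incidentWeight v c i ≈ w c i
    sum-incidentWeight-edge c i = begin
      ∑[ v < n ] incidentWeight v c i          ≈⟨ sum-supported-at _ (lookup (scope c) i) vanishing ⟩
      incidentWeight (lookup (scope c) i) c i  ≡⟨ incidentWeight-≡ ≡.refl ⟩
      w c i                                    ∎
      where
      vanishing : ∀ v → v ≢ lookup (scope c) i → incidentWeight v c i ≈ ε
      vanishing v v≢ = reflexive (incidentWeight-≢ (λ eq → v≢ (≡.sym eq)))

    sum-incidentWeight-endpoint : ∀ {v c} p → lookup (scope c) p ≡ v →
                                  ∑[ i < arity c ] incidentWeight v c i ≈ w c p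
    sum-incidentWeight-endpoint {v} {c} p at = begin
      ∑[ i < arity c ] incidentWeight v c i  ≈⟨ sum-supported-at _ p vanishing ⟩
      incidentWeight v c p                   ≡⟨ incidentWeight-≡ at ⟩
      w c p                                  ∎
      where
      vanishing : ∀ i → i ≢ p → incidentWeight v c i ≈ ε
      vanishing i i≢p =
        reflexive (incidentWeight-≢ (λ eq → i≢p (distinct c i p (≡.trans eq (≡.sym at)))))

    sum-incidentWeight-variable : ∀ v →
      ∑[ c < m ] ∑[ i < arity c ] incidentWeight v c i ≈ w (con₁ v) (pos₁ v) ∙ w (con₂ v) (pos₂ v)
    sum-incidentWeight-variable v = begin
      ∑[ c < m ] ∑[ i < arity c ] incidentWeight v c i
        ≈⟨ sum-supported-at-pair _ (con-distinct v) vanishing ⟩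
      ∑[ i < arity (con₁ v) ] incidentWeight v (con₁ v) i ∙
      ∑[ i < arity (con₂ v) ] incidentWeight v (con₂ v) i
        ≈⟨ ∙-cong (sum-incidentWeight-endpoint (pos₁ v) (at₁ v))
                  (sum-incidentWeight-endpoint (pos₂ v) (at₂ v)) ⟩
      w (con₁ v) (pos₁ v) ∙ w (con₂ v) (pos₂ v)
        ∎
      where
      vanishing : ∀ c → c ≢ con₁ v → c ≢ con₂ v → ∑[ i < arity c ] incidentWeight v c i ≈ ε
      vanishing c c≢₁ c≢₂ = sum-vanishing _ λ i →
        reflexive (incidentWeight-≢ λ at → [ c≢₁ , c≢₂ ] (only-two v c i at))

  handshake : (w : EdgeWeight) →
    ∑[ v < n ] (w (con₁ v) (pos₁ v) ∙ w (con₂ v) (pos₂ v)) ≈ ∑[ c < m ] ∑[ i < arity c ] w c i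
  handshake w = begin
    ∑[ v < n ] (w (con₁ v) (pos₁ v) ∙ w (con₂ v) (pos₂ v))
      ≈⟨ sum-cong-≋ (λ v → sym (sum-incidentWeight-variable w v)) ⟩
    ∑[ v < n ] ∑[ c < m ] ∑[ i < arity c ] incidentWeight w v c i
      ≈⟨ ∑-comm (λ v c → ∑[ i < arity c ] incidentWeight w v c i) ⟩
    ∑[ c < m ] ∑[ v < n ] ∑[ i < arity c ] incidentWeight w v c i
      ≈⟨ sum-cong-≋ (λ c → ∑-comm (λ v i → incidentWeight w v c i)) ⟩
    ∑[ c < m ] ∑[ i < arity c ] ∑[ v < n ] incidentWeight w v c i
      ≈⟨ sum-cong-≋ (λ c → sum-cong-≋ (sum-incidentWeight-edge w c)) ⟩
    ∑[ c < m ] ∑[ i < arity c ] w c i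
      ∎

⊕-commutativeMonoid : CommutativeMonoid _ _
⊕-commutativeMonoid = CommutativeRing.+-commutativeMonoid xor-∧-commutativeRing

open MonoidSum ⊕-commutativeMonoid using (sum; sum-syntax; sum-cong-≗; ∑-distrib-+; sum-replicate-zero)
open Algebra.Properties.CommutativeSemigroup
  (CommutativeMonoid.commutativeSemigroup ⊕-commutativeMonoid) using (interchange)

isOdd : ℕ → Bool
isOdd zero    = false
isOdd (suc n) = not (isOdd n)

%2≡if-isOdd : ∀ n → n % 2 ≡ (if isOdd n then 1 else 0)
%2≡if-isOdd zero          = ≡.refl
%2≡if-isOdd (suc zero)    = ≡.refl
%2≡if-isOdd (suc (suc n)) =
  ≡.trans (%2≡if-isOdd n) (≡.cong (if_then 1 else 0) (≡.sym (not-involutive (isOdd n))))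

%2-cong-isOdd : ∀ m n → isOdd m ≡ isOdd n → m % 2 ≡ n % 2
%2-cong-isOdd m n eq =
  ≡.trans (%2≡if-isOdd m) (≡.trans (≡.cong (if_then 1 else 0) eq) (≡.sym (%2≡if-isOdd n)))

isOdd-cong-%2 : ∀ m n → m % 2 ≡ n % 2 → isOdd m ≡ isOdd n
isOdd-cong-%2 m n eq =
  if-1-0-injective (≡.trans (≡.sym (%2≡if-isOdd m)) (≡.trans eq (%2≡if-isOdd n)))
  where
  if-1-0-injective : ∀ {a b} → (if a then 1 else 0) ≡ (if b then 1 else 0) → a ≡ b
  if-1-0-injective {true}  {true}  _ = ≡.refl
  if-1-0-injective {false} {false} _ = ≡.refl

isOdd-countᵇ : ∀ {A : Set} {k} (p : A → Bool) (xs : Vec A k) →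
               isOdd (countᵇ p xs) ≡ ∑[ i < k ] p (lookup xs i)
isOdd-countᵇ p []       = ≡.refl
isOdd-countᵇ p (x ∷ xs) with p x
... | true  = ≡.cong not (isOdd-countᵇ p xs)
... | false = isOdd-countᵇ p xs

xor≡false⇒≡ : ∀ {a b} → a xor b ≡ false → a ≡ b
xor≡false⇒≡ {true}  {true}  _ = ≡.refl
xor≡false⇒≡ {false} {false} _ = ≡.refl

disagreements-even : ∀ {k} {R : Vec Bool k → Set} → IsEven R → ∀ {α β} → R α → R β →
                     ∑[ i < k ] (lookup α i xor lookup β i) ≡ false
disagreements-even {k} even {α} {β} Rα Rβ = begin
  ∑[ i < k ] (lookup α i xor lookup β i)  ≡⟨ ∑-distrib-+ (lookup α) (lookup β) ⟩
  sum (lookup α) xor sum (lookup β)      ≡⟨ ≡.cong₂ _xor_ (isOdd-countᵇ id α) (isOdd-countᵇ id β) ⟨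
  isOdd (ones α) xor isOdd (ones β)      ≡⟨ ≡.cong (_xor isOdd (ones β)) same-parity ⟩
  isOdd (ones β) xor isOdd (ones β)      ≡⟨ xor-same (isOdd (ones β)) ⟩
  false                                  ∎
  where
  open ≡.≡-Reasoning
  same-parity : isOdd (ones α) ≡ isOdd (ones β)
  same-parity = isOdd-cong-%2 (ones α) (ones β) (even α β Rα Rβ)

module _ {n m : ℕ} (I : EdgeCSP n m) where
  open EdgeCSP I
  open Handshake ⊕-commutativeMonoid I using (handshake)

  isOdd-numInconsistent : ∀ f → isOdd (numInconsistent I f) ≡ ∑[ v < n ] inconsistentᵇ I f v
  isOdd-numInconsistent f = ≡.trans (isOdd-countᵇ (inconsistentᵇ I f) (allFin n))
                                    (sum-cong-≗ (λ v → ≡.cong (inconsistentᵇ I f) (lookup-allFin v)))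

  isOdd-numInconsistent-xor : ∀ f g →
    isOdd (numInconsistent I f) xor isOdd (numInconsistent I g)
      ≡ ∑[ c < m ] ∑[ i < arity c ] (lookup (f c) i xor lookup (g c) i)
  isOdd-numInconsistent-xor f g = begin
    isOdd (numInconsistent I f) xor isOdd (numInconsistent I g)
      ≡⟨ ≡.cong₂ _xor_ (isOdd-numInconsistent f) (isOdd-numInconsistent g) ⟩
    ∑[ v < n ] inconsistentᵇ I f v xor ∑[ v < n ] inconsistentᵇ I g v
      ≡⟨ ∑-distrib-+ (inconsistentᵇ I f) (inconsistentᵇ I g) ⟨
    ∑[ v < n ] (inconsistentᵇ I f v xor inconsistentᵇ I g v)
      ≡⟨ sum-cong-≗ (λ v → interchange (f₁ v) (f₂ v) (g₁ v) (g₂ v)) ⟩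
    ∑[ v < n ] ((f₁ v xor g₁ v) xor (f₂ v xor g₂ v))
      ≡⟨ handshake (λ c i → lookup (f c) i xor lookup (g c) i) ⟩
    ∑[ c < m ] ∑[ i < arity c ] (lookup (f c) i xor lookup (g c) i)
      ∎
    where
    open ≡.≡-Reasoning
    f₁ f₂ g₁ g₂ : Fin n → Bool
    f₁ v = lookup (f (con₁ v)) (pos₁ v)
    f₂ v = lookup (f (con₂ v)) (pos₂ v)
    g₁ v = lookup (g (con₁ v)) (pos₁ v)
    g₂ v = lookup (g (con₂ v)) (pos₂ v)

mainTheorem7 : {n m : ℕ} (I : EdgeCSP n m) →
    (∀ c → IsEvenDeltaMatroid (EdgeCSP.rel I c)) →
    (f g : Labeling I) → Valid I f → Valid I g →
    numInconsistent I f % 2 ≡ numInconsistent I g % 2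
mainTheorem7 {m = m} I evenΔ f g valid-f valid-g =
  %2-cong-isOdd (numInconsistent I f) (numInconsistent I g) (xor≡false⇒≡ parity-difference≡false)
  where
  open ≡.≡-Reasoning
  open EdgeCSP I using (arity)

  parity-difference≡false : isOdd (numInconsistent I f) xor isOdd (numInconsistent I g) ≡ false
  parity-difference≡false = begin
    isOdd (numInconsistent I f) xor isOdd (numInconsistent I g)
      ≡⟨ isOdd-numInconsistent-xor I f g ⟩
    ∑[ c < m ] ∑[ i < arity c ] (lookup (f c) i xor lookup (g c) i)
      ≡⟨ sum-cong-≗ (λ c → disagreements-even (proj₂ (evenΔ c)) (valid-f c) (valid-g c)) ⟩
    ∑[ c < m ] false
      ≡⟨ sum-replicate-zero m ⟩
    false
      ∎
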